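{- Let $n\geq2$, $\overline{m}=(m_1,\dots,m_n)\in\mathbb{N}^n$ with $m_1\leq\dots\leq m_n$, and let $K_{\overline{m}}$ be the complete $n$-partite graph with parts of sizes $m_1,\dots,m_n$. Then $$\gamma_{e,g}(K_{\overline{m}})\leq 2\max\left\{\left\lceil\tfrac12\sum_{j=1}^{n-1}m_j\right\rceil,\ m_{n-1}\right\}-1.$$
   Context: For an edge $e$ of a graph $G$, $N[e]$ denotes $e$ together with all edges sharing an endpoint with $e$. In the edge domination game on $G$, Dominator and Staller alternately choose edges, Dominator first; each chosen edge $s_i$ must satisfy $N[s_i]\setminus\bigcup_{j<i}N[s_j]\neq\emptyset$; the game ends when all edges lie in $\bigcup_jN[s_j]$. Dominator minimizes and Staller maximizes the number of moves; $\gamma_{e,g}(G)$ is the number of moves under optimal play. $K_{\overline{m}}$ has vertex set the disjoint union of independent sets $V_1,\dots,V_n$ with $|V_j|=m_j$, with vertices in different parts adjacent. -}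

module Defs where

open import Data.Nat using (ℕ; zero; suc; _⊓_; _⊔_; _<?_)
open import Data.Bool using (Bool; true; false; not; _∨_; if_then_else_)
open import Data.List using (List; []; _∷_; foldr; filter; map; length; concatMap; allFin)
open import Data.Bool.ListAction using (any)
open import Data.Product using (Σ; _×_; _,_; proj₁; proj₂)
open import Data.Fin using (Fin; toℕ)
import Data.Fin.Properties as FinP
open import Data.Product.Properties using (≡-dec)
open import Relation.Binary.Definitions using (DecidableEquality)
open import Relation.Nullary.Decidable using (⌊_⌋; ¬?)

-- A finite graph: a vertex type with decidable equality and a list of edges,
-- each edge an (unordered) pair of distinct vertices listed exactly once.
record Graph : Set₁ where
  field
    V     : Set
    _≟V_  : DecidableEquality V
    edges : List (V × V)

module _ (G : Graph) where
  open Graph G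

  Edge : Set
  Edge = V × V

  -- meets e f : f ∈ N[e], i.e. f = e or f shares an endpoint with e
  meets : Edge → Edge → Bool
  meets (a , b) (c , d) =
    ⌊ a ≟V c ⌋ ∨ ⌊ a ≟V d ⌋ ∨ ⌊ b ≟V c ⌋ ∨ ⌊ b ≟V d ⌋

  minL : List ℕ → ℕ
  minL []       = 0
  minL (x ∷ xs) = foldr _⊓_ x xs

  maxL : List ℕ → ℕ
  maxL = foldr _⊔_ 0

  -- game k p R : number of remaining moves under optimal play, when R is the
  -- list of not-yet-dominated edges, p = true iff it is Dominator's turn,
  -- and k is fuel (each legal move dominates ≥ 1 new edge, so k = length R
  -- suffices).
  game : ℕ → Bool → List Edge → ℕ
  game zero    p R        = 0
  game (suc k) p []       = 0
  game (suc k) p (r ∷ rs) =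
    suc (opt p (map (λ e → game k (not p) (filter (λ f → ¬? (meets e f Data.Bool.≟ true)) R)) legal))
    where
      R : List Edge
      R = r ∷ rs
      legal : List Edge
      legal = filter (λ e → any (meets e) R Data.Bool.≟ true) edges
      opt : Bool → List ℕ → ℕ
      opt true  = minL
      opt false = maxL

  γeg : ℕ
  γeg = game (length edges) true edges

-- Vertices are pairs (j , i) with i : Fin (m j); an edge joins vertices in
-- different parts; each edge is listed once, as (u , v) with part u < part v.
completeMultipartite : (n : ℕ) → (Fin n → ℕ) → Graph
completeMultipartite n m = record
  { V     = Vtx
  ; _≟V_  = ≡-dec FinP._≟_ FinP._≟_
  ; edges = filter (λ uv → toℕ (proj₁ (proj₁ uv)) <? toℕ (proj₁ (proj₂ uv)))
                   (concatMap (λ u → map (u ,_) vs) vs)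
  }
  where
    Vtx : Set
    Vtx = Σ (Fin n) (λ j → Fin (m j))
    vs : List Vtx
    vs = concatMap (λ j → map (j ,_) (allFin (m j))) (allFin n)

-- Count, for every part j, the vertices of V_j not yet covered by a chosen edge: an edge is still
-- undominated iff both its endpoints are uncovered, so a position is described by these counts.
-- Fix a centre part and call the counts t-balanced when the other parts hold at most 2t uncovered
-- vertices in total and at most t each.  Staller's moves keep the counts t-balanced.  Dominator can
-- make them (t-1)-balanced: among the non-centre parts at most two have t or more uncovered vertices
-- (three would exceed 2t), so he plays an edge between two non-centre parts containing all of them,
-- or, if only one non-centre part is nonempty, between it and the centre.  Hence from a t-balanced
-- position at most 2t-1 moves remain with Dominator to move and 2t with Staller to move.  With the
-- last part as centre the initial counts m are t-balanced for t = max(⌈(m_1 + ... + m_{n-1})/2⌉, m_{n-1}).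
module Submission where

open import Defs
open import Data.Bool using (Bool; true; false; not; _∧_; _∨_)
import Data.Bool as Bool
open import Data.Bool.ListAction using (any)
open import Data.Bool.Properties using (∨-∧-booleanAlgebra; ∧-commutativeMonoid; ∨-zeroʳ; T-≡)
open import Data.Fin using (Fin; zero; suc; toℕ; fromℕ; inject₁; lower₁)
import Data.Fin.Properties as Fin
open import Data.List using (List; []; _∷_; filter; map; concatMap; allFin; tabulate; length)
open import Data.List.Membership.Propositional using (_∈_)
open import Data.List.Membership.Propositional.Properties
  using (∈-filter⁺; ∈-filter⁻; ∈-map⁺; ∈-concatMap⁺; ∈-allFin)
open import Data.List.Properties using (foldr-preservesᵒ; foldr-preservesᵇ; filter-all; map-tabulate)
open import Data.List.Relation.Unary.All using (All; universal)
open import Data.List.Relation.Unary.All.Properties using (map⁺)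
import Data.List.Relation.Unary.Any as Any
open import Data.List.Relation.Unary.Any using (here)
open import Data.List.Relation.Unary.Any.Properties using (any⁺)
open import Data.Nat using (ℕ; zero; suc; pred; _+_; _*_; _∸_; _≤_; _<_; z≤n; s≤s; s≤s⁻¹; _⊔_;
  _≤?_; _<?_; ⌈_/2⌉; ⌊_/2⌋)
open import Data.Nat.ListAction using (sum)
open import Data.Nat.Properties
open import Data.Product using (∃; ∃₂; _×_; _,_; proj₁; proj₂)
import Data.Sum
open import Data.Sum using ([_,_])
open import Data.Vec.Functional using (updateAt; init)
open import Data.Vec.Functional.Properties using (updateAt-updates; updateAt-minimal)
open import Function using (_∘_; id; const)
open import Function.Bundles using (Equivalence)
open import Relation.Binary using (tri<; tri≈; tri>)
open import Relation.Binary.PropositionalEquality hiding ([_])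
open import Relation.Nullary using (Dec; yes; no; contradiction; ¬?)
open import Relation.Nullary.Decidable using (⌊_⌋; _×-dec_)
open import Algebra.Lattice.Properties.BooleanAlgebra ∨-∧-booleanAlgebra using (deMorgan₂)
open import Algebra.Properties.CommutativeMonoid.Sum +-0-commutativeMonoid using ()
  renaming (sum to ∑; sum-replicate-zero to ∑-replicate-zero; sum-init-last to ∑-init-last; sum-cong-≗ to ∑-cong)
open import Algebra.Properties.CommutativeSemigroup +-commutativeSemigroup using (x∙yz≈y∙xz)
open import Algebra.Solver.CommutativeMonoid ∧-commutativeMonoid using (solve; _⊕_; _⊜_)

private variable n : ℕ

-- Finite sums over Fin

infix 4 _≤̇_
_≤̇_ : (f g : Fin n → ℕ) → Set
f ≤̇ g = ∀ i → f i ≤ g i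

zeroAt : Fin n → (Fin n → ℕ) → Fin n → ℕ
zeroAt j f = updateAt f j (const 0)

zeroAt-≡0 : ∀ j (f : Fin n → ℕ) → zeroAt j f j ≡ 0
zeroAt-≡0 j f = updateAt-updates j f

zeroAt-≢ : ∀ {i j} (f : Fin n → ℕ) → i ≢ j → zeroAt j f i ≡ f i
zeroAt-≢ {i = i} {j} f = updateAt-minimal i j f

zeroAt-mono : ∀ j {f g : Fin n → ℕ} → f ≤̇ g → zeroAt j f ≤̇ zeroAt j g
zeroAt-mono j {f} {g} f≤g i with i Fin.≟ j
... | yes refl = subst (_≤ zeroAt j g j) (sym (zeroAt-≡0 j f)) z≤n
... | no i≢j   = subst₂ _≤_ (sym (zeroAt-≢ f i≢j)) (sym (zeroAt-≢ g i≢j)) (f≤g i)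

∑-mono-≤ : {f g : Fin n → ℕ} → f ≤̇ g → ∑ f ≤ ∑ g
∑-mono-≤ {zero}  f≤g = z≤n
∑-mono-≤ {suc n} f≤g = +-mono-≤ (f≤g zero) (∑-mono-≤ (f≤g ∘ suc))

∑-split : ∀ j (f : Fin n → ℕ) → ∑ f ≡ f j + ∑ (zeroAt j f)
∑-split zero    f = refl
∑-split (suc j) f = begin
  f zero + ∑ (f ∘ suc)                           ≡⟨ cong (f zero +_) (∑-split j (f ∘ suc)) ⟩
  f zero + (f (suc j) + ∑ (zeroAt j (f ∘ suc)))  ≡⟨ x∙yz≈y∙xz (f zero) (f (suc j)) _ ⟩
  f (suc j) + (f zero + ∑ (zeroAt j (f ∘ suc)))  ∎
  where open ≡-Reasoning

∑-split₂ : ∀ {i j} (f : Fin n → ℕ) → i ≢ j → ∑ f ≡ f i + f j + ∑ (zeroAt j (zeroAt i f))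
∑-split₂ {i = i} {j} f i≢j = begin
  ∑ f                                   ≡⟨ ∑-split i f ⟩
  f i + ∑ (zeroAt i f)                  ≡⟨ cong (f i +_) (∑-split j (zeroAt i f)) ⟩
  f i + (zeroAt i f j + ∑ rest)         ≡⟨ cong (λ x → f i + (x + ∑ rest)) (zeroAt-≢ f (i≢j ∘ sym)) ⟩
  f i + (f j + ∑ rest)                  ≡⟨ +-assoc (f i) (f j) (∑ rest) ⟨
  f i + f j + ∑ rest                    ∎
  where
  open ≡-Reasoning
  rest : Fin _ → ℕ
  rest = zeroAt j (zeroAt i f)

term≤∑ : ∀ (f : Fin n → ℕ) i → f i ≤ ∑ f
term≤∑ f i = subst (f i ≤_) (sym (∑-split i f)) (m≤m+n (f i) _)

terms≤∑₃ : ∀ (f : Fin n → ℕ) {a b c} → a ≢ b → a ≢ c → b ≢ c → f a + f b + f c ≤ ∑ f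
terms≤∑₃ f {a} {b} {c} a≢b a≢c b≢c = begin
  f a + f b + f c                        ≡⟨ cong (f a + f b +_) rest[c]≡f[c] ⟨
  f a + f b + zeroAt b (zeroAt a f) c    ≤⟨ +-monoʳ-≤ (f a + f b) (term≤∑ _ c) ⟩
  f a + f b + ∑ (zeroAt b (zeroAt a f))  ≡⟨ ∑-split₂ f a≢b ⟨
  ∑ f                                    ∎
  where
  open ≤-Reasoning
  rest[c]≡f[c] : zeroAt b (zeroAt a f) c ≡ f c
  rest[c]≡f[c] = trans (zeroAt-≢ _ (b≢c ∘ sym)) (zeroAt-≢ f (a≢c ∘ sym))

∑-mono-< : ∀ {f g : Fin n → ℕ} i → f ≤̇ g → f i < g i → ∑ f < ∑ g
∑-mono-< {f = f} {g} i f≤g fi<gi = subst₂ _<_ (sym (∑-split i f)) (sym (∑-split i g))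
  (+-mono-<-≤ fi<gi (∑-mono-≤ (zeroAt-mono i f≤g)))

∑-mono-<₂ : ∀ {f g : Fin n → ℕ} {i j} → i ≢ j → f ≤̇ g → f i < g i → f j < g j → 2 + ∑ f ≤ ∑ g
∑-mono-<₂ {f = f} {g} {i} {j} i≢j f≤g fi<gi fj<gj = begin
  2 + ∑ f                                      ≡⟨ cong (2 +_) (∑-split₂ f i≢j) ⟩
  suc (suc (f i + f j + ∑ (rest f)))           ≡⟨ cong (λ x → suc (x + ∑ (rest f))) (+-suc (f i) (f j)) ⟨
  suc (f i) + suc (f j) + ∑ (rest f)           ≤⟨ +-mono-≤ (+-mono-≤ fi<gi fj<gj) (∑-mono-≤ rest-mono) ⟩
  g i + g j + ∑ (rest g)                       ≡⟨ ∑-split₂ g i≢j ⟨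
  ∑ g                                          ∎
  where
  open ≤-Reasoning
  rest : (Fin _ → ℕ) → Fin _ → ℕ
  rest h = zeroAt j (zeroAt i h)
  rest-mono : rest f ≤̇ rest g
  rest-mono = zeroAt-mono j (zeroAt-mono i f≤g)

∑-≡0 : {f : Fin n → ℕ} → (∀ i → f i ≡ 0) → ∑ f ≡ 0
∑-≡0 {n} f≡0 = n≤0⇒n≡0 (≤-trans (∑-mono-≤ (≤-reflexive ∘ f≡0)) (≤-reflexive (∑-replicate-zero n)))

∑-pos⇒∃-pos : ∀ (f : Fin n → ℕ) → 1 ≤ ∑ f → ∃ λ i → 1 ≤ f i
∑-pos⇒∃-pos f 1≤∑f with Fin.any? (λ i → 1 ≤? f i)
... | yes found = found
... | no none   = contradiction (∑-≡0 λ i → n<1⇒n≡0 (≰⇒> (none ∘ (i ,_)))) (<⇒≢ 1≤∑f ∘ sym)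

∑-const : ∀ n x → ∑ (λ (_ : Fin n) → x) ≡ n * x
∑-const zero    x = refl
∑-const (suc n) x = cong (x +_) (∑-const n x)

sum-tabulate : ∀ (f : Fin n → ℕ) → sum (tabulate f) ≡ ∑ f
sum-tabulate {zero}  f = refl
sum-tabulate {suc n} f = cong (f zero +_) (sum-tabulate (f ∘ suc))

sum-map-allFin : ∀ (f : Fin n → ℕ) → sum (map f (allFin n)) ≡ ∑ f
sum-map-allFin f = trans (cong sum (map-tabulate id f)) (sum-tabulate f)

2+≤2*⇒≤2*pred : ∀ {x} t → 2 + x ≤ 2 * t → x ≤ 2 * pred t
2+≤2*⇒≤2*pred {x} (suc t) le = s≤s⁻¹ (subst (suc x ≤_) (+-suc t (t + 0)) (s≤s⁻¹ le))

suc[2*pred]≡2*∸1 : ∀ {t} → 1 ≤ t → suc (2 * pred t) ≡ 2 * t ∸ 1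
suc[2*pred]≡2*∸1 {suc t} _ = sym (+-suc t (t + 0))

suc[2*∸1]≡2* : ∀ {t} → 1 ≤ t → suc (2 * t ∸ 1) ≡ 2 * t
suc[2*∸1]≡2* {suc t} _ = refl

n≤2*⌈n/2⌉ : ∀ n → n ≤ 2 * ⌈ n /2⌉
n≤2*⌈n/2⌉ n = begin
  n                    ≡⟨ ⌊n/2⌋+⌈n/2⌉≡n n ⟨
  ⌊ n /2⌋ + ⌈ n /2⌉    ≤⟨ +-monoˡ-≤ ⌈ n /2⌉ (⌊n/2⌋≤⌈n/2⌉ n) ⟩
  ⌈ n /2⌉ + ⌈ n /2⌉    ≡⟨ cong (⌈ n /2⌉ +_) (+-identityʳ ⌈ n /2⌉) ⟨
  2 * ⌈ n /2⌉          ∎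
  where open ≤-Reasoning

-- Balanced counts

Balanced : Fin n → ℕ → (Fin n → ℕ) → Set
Balanced j t u = ∑ (zeroAt j u) ≤ 2 * t × (∀ i → i ≢ j → u i ≤ t)

Balanced-antitone : ∀ {j t} {u v : Fin n → ℕ} → v ≤̇ u → Balanced j t u → Balanced j t v
Balanced-antitone {j = j} v≤u (∑≤ , outer≤) =
  ≤-trans (∑-mono-≤ (zeroAt-mono j v≤u)) ∑≤ , λ i i≢j → ≤-trans (v≤u i) (outer≤ i i≢j)

Balanced-last : ∀ {N t} (u : Fin (suc N) → ℕ) → ∑ (init u) ≤ 2 * t → (∀ i → u (inject₁ i) ≤ t) →
                Balanced (fromℕ N) t u
Balanced-last {N} {t} u ∑≤ init≤ = ≤-trans (≤-reflexive ∑≡) ∑≤ , outer≤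
  where
  ∑≡ : ∑ (zeroAt (fromℕ N) u) ≡ ∑ (init u)
  ∑≡ = begin
    ∑ (zeroAt (fromℕ N) u)                                        ≡⟨ ∑-init-last (zeroAt (fromℕ N) u) ⟩
    ∑ (init (zeroAt (fromℕ N) u)) + zeroAt (fromℕ N) u (fromℕ N)  ≡⟨ cong₂ _+_ (∑-cong init≡) (zeroAt-≡0 (fromℕ N) u) ⟩
    ∑ (init u) + 0                                                ≡⟨ +-identityʳ _ ⟩
    ∑ (init u)                                                    ∎
    where
    open ≡-Reasoning
    init≡ : ∀ i → zeroAt (fromℕ N) u (inject₁ i) ≡ u (inject₁ i)
    init≡ i = zeroAt-≢ u (Fin.fromℕ≢inject₁ {i = i} ∘ sym)
  outer≤ : ∀ i → i ≢ fromℕ N → u i ≤ t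
  outer≤ i i≢last = subst (λ i → u i ≤ t) (Fin.inject₁-lower₁ i N≢i) (init≤ (lower₁ i N≢i))
    where
    N≢i : N ≢ toℕ i
    N≢i N≡i = i≢last (Fin.toℕ-injective (trans (sym N≡i) (sym (Fin.toℕ-fromℕ N))))

ReducesBudget : Fin n → ℕ → (Fin n → ℕ) → Fin n → Fin n → Set
ReducesBudget j t u p q = ∀ v → v ≤̇ u → v p < u p → v q < u q → Balanced j (pred t) v

reducesBudget-outer : ∀ {j t} {u : Fin n → ℕ} {p q} → Balanced j t u → p ≢ q → p ≢ j → q ≢ j →
                      (∀ i → i ≢ j → i ≢ p → i ≢ q → u i < t) → ReducesBudget j t u p q
reducesBudget-outer {j = j} {t} {u} {p} {q} (∑≤ , outer≤) p≢q p≢j q≢j others<t v v≤u vp<up vq<uq =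
  2+≤2*⇒≤2*pred t (≤-trans ∑v+2≤∑u ∑≤) , outer≤pred
  where
  outer-< : ∀ {i} → i ≢ j → v i < u i → zeroAt j v i < zeroAt j u i
  outer-< i≢j = subst₂ _<_ (sym (zeroAt-≢ v i≢j)) (sym (zeroAt-≢ u i≢j))
  ∑v+2≤∑u : 2 + ∑ (zeroAt j v) ≤ ∑ (zeroAt j u)
  ∑v+2≤∑u = ∑-mono-<₂ p≢q (zeroAt-mono j v≤u) (outer-< p≢j vp<up) (outer-< q≢j vq<uq)
  outer≤pred : ∀ i → i ≢ j → v i ≤ pred t
  outer≤pred i i≢j with i Fin.≟ p | i Fin.≟ q
  ... | yes refl | _        = <⇒≤pred (<-≤-trans vp<up (outer≤ p p≢j))
  ... | no _     | yes refl = <⇒≤pred (<-≤-trans vq<uq (outer≤ q q≢j))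
  ... | no i≢p   | no i≢q   = <⇒≤pred (≤-<-trans (v≤u i) (others<t i i≢j i≢p i≢q))

reducesBudget-centre : ∀ {j t} {u : Fin n → ℕ} {x} → Balanced j t u → x ≢ j →
                       (∀ i → i ≢ j → i ≢ x → u i ≡ 0) → ReducesBudget j t u x j
reducesBudget-centre {j = j} {t} {u} {x} (_ , outer≤) x≢j others≡0 v v≤u vx<ux _ = ∑≤ , outer≤pred
  where
  vx≤pred : v x ≤ pred t
  vx≤pred = <⇒≤pred (<-≤-trans vx<ux (outer≤ x x≢j))
  v≡0 : ∀ {i} → i ≢ j → i ≢ x → v i ≡ 0
  v≡0 {i} i≢j i≢x = n≤0⇒n≡0 (subst (v i ≤_) (others≡0 i i≢j i≢x) (v≤u i))
  rest≡0 : ∀ i → zeroAt x (zeroAt j v) i ≡ 0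
  rest≡0 i with i Fin.≟ x | i Fin.≟ j
  ... | yes refl | _        = zeroAt-≡0 x _
  ... | no i≢x   | yes refl = trans (zeroAt-≢ _ i≢x) (zeroAt-≡0 j v)
  ... | no i≢x   | no i≢j   = trans (zeroAt-≢ _ i≢x) (trans (zeroAt-≢ v i≢j) (v≡0 i≢j i≢x))
  ∑≤ : ∑ (zeroAt j v) ≤ 2 * pred t
  ∑≤ = begin
    ∑ (zeroAt j v)                            ≡⟨ ∑-split x (zeroAt j v) ⟩
    zeroAt j v x + ∑ (zeroAt x (zeroAt j v))  ≡⟨ cong₂ _+_ (zeroAt-≢ v x≢j) (∑-≡0 rest≡0) ⟩
    v x + 0                                   ≡⟨ +-identityʳ (v x) ⟩
    v x                                       ≤⟨ vx≤pred ⟩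
    pred t                                    ≤⟨ m≤n*m (pred t) 2 ⟩
    2 * pred t                                ∎
    where open ≤-Reasoning
  outer≤pred : ∀ i → i ≢ j → v i ≤ pred t
  outer≤pred i i≢j with i Fin.≟ x
  ... | yes refl = vx≤pred
  ... | no i≢x   = subst (_≤ pred t) (sym (v≡0 i≢j i≢x)) z≤n

record DominatorPair (j : Fin n) (t : ℕ) (u : Fin n → ℕ) : Set where
  field
    {p q}   : Fin n
    p≢q     : p ≢ q
    1≤u[p]  : 1 ≤ u p
    1≤u[q]  : 1 ≤ u q
    reduces : ReducesBudget j t u p q

module _ {j : Fin n} {t : ℕ} {u : Fin n → ℕ} (bal : Balanced j t u) where

  private
    pos⇒1≤t : ∀ {i} → i ≢ j → 1 ≤ u i → 1 ≤ t
    pos⇒1≤t i≢j 1≤ui = ≤-trans 1≤ui (proj₂ bal _ i≢j)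

  Balanced⇒1≤t : ∀ {p q} → p ≢ q → 1 ≤ u p → 1 ≤ u q → 1 ≤ t
  Balanced⇒1≤t {p} {q} p≢q 1≤up 1≤uq with p Fin.≟ j
  ... | no p≢j   = pos⇒1≤t p≢j 1≤up
  ... | yes refl = pos⇒1≤t (p≢q ∘ sym) 1≤uq

  no-three-large : ∀ {a b c} → 1 ≤ t → a ≢ b → a ≢ c → b ≢ c → a ≢ j → b ≢ j → c ≢ j →
                   t ≤ u a → t ≤ u b → u c < t
  no-three-large {a} {b} {c} 1≤t a≢b a≢c b≢c a≢j b≢j c≢j t≤ua t≤ub =
    ≰⇒> λ t≤uc → <⇒≱ (m<m+n (t + t) 1≤t) (begin
      t + t + t                                   ≤⟨ +-mono-≤ (+-mono-≤ t≤ua t≤ub) t≤uc ⟩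
      u a + u b + u c                             ≡⟨ cong₂ _+_ (cong₂ _+_ (outer a≢j) (outer b≢j)) (outer c≢j) ⟨
      zeroAt j u a + zeroAt j u b + zeroAt j u c  ≤⟨ terms≤∑₃ (zeroAt j u) a≢b a≢c b≢c ⟩
      ∑ (zeroAt j u)                              ≤⟨ proj₁ bal ⟩
      2 * t                                       ≡⟨ cong (t +_) (+-identityʳ t) ⟩
      t + t                                       ∎)
    where
    open ≤-Reasoning
    outer : ∀ {i} → i ≢ j → zeroAt j u i ≡ u i
    outer = zeroAt-≢ u

  private
    outerPair : ∀ {p q} → p ≢ q → p ≢ j → q ≢ j → 1 ≤ u p → 1 ≤ u q →
                (∀ i → i ≢ j → i ≢ p → i ≢ q → u i < t) → DominatorPair j t u
    outerPair p≢q p≢j q≢j 1≤up 1≤uq small = record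
      { p≢q = p≢q ; 1≤u[p] = 1≤up ; 1≤u[q] = 1≤uq ; reduces = reducesBudget-outer bal p≢q p≢j q≢j small }

  dominatorPair-outer : ∀ {a b} → a ≢ b → a ≢ j → b ≢ j → 1 ≤ u a → 1 ≤ u b → DominatorPair j t u
  dominatorPair-outer {a} {b} a≢b a≢j b≢j 1≤ua 1≤ub with Fin.any? (λ r → ¬? (r Fin.≟ j) ×-dec t ≤? u r)
  ... | no none = outerPair a≢b a≢j b≢j 1≤ua 1≤ub λ i i≢j _ _ → ≰⇒> λ t≤ui → none (i , i≢j , t≤ui)
  ... | yes (r , r≢j , t≤ur)
    with Fin.any? (λ r′ → ¬? (r′ Fin.≟ j) ×-dec ¬? (r′ Fin.≟ r) ×-dec t ≤? u r′)
  ...   | yes (r′ , r′≢j , r′≢r , t≤ur′) =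
          outerPair (r′≢r ∘ sym) r≢j r′≢j (≤-trans 1≤t t≤ur) (≤-trans 1≤t t≤ur′) λ i i≢j i≢r i≢r′ →
            no-three-large 1≤t (r′≢r ∘ sym) (i≢r ∘ sym) (i≢r′ ∘ sym) r≢j r′≢j i≢j t≤ur t≤ur′
    where
    1≤t : 1 ≤ t
    1≤t = pos⇒1≤t a≢j 1≤ua
  ...   | no only-r with a Fin.≟ r
  ...     | yes refl = outerPair a≢b a≢j b≢j 1≤ua 1≤ub λ i i≢j i≢r _ →
                         ≰⇒> λ t≤ui → only-r (i , i≢j , i≢r , t≤ui)
  ...     | no a≢r   = outerPair (a≢r ∘ sym) r≢j a≢j (≤-trans (pos⇒1≤t a≢j 1≤ua) t≤ur) 1≤ua
                         λ i i≢j i≢r _ → ≰⇒> λ t≤ui → only-r (i , i≢j , i≢r , t≤ui)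

  dominatorPair-centre : ∀ {x} → x ≢ j → 1 ≤ u x → 1 ≤ u j → DominatorPair j t u
  dominatorPair-centre {x} x≢j 1≤ux 1≤uj
    with Fin.any? (λ r → ¬? (r Fin.≟ j) ×-dec ¬? (r Fin.≟ x) ×-dec 1 ≤? u r)
  ... | yes (r , r≢j , r≢x , 1≤ur) = dominatorPair-outer (r≢x ∘ sym) x≢j r≢j 1≤ux 1≤ur
  ... | no none = record
    { p≢q = x≢j ; 1≤u[p] = 1≤ux ; 1≤u[q] = 1≤uj
    ; reduces = reducesBudget-centre bal x≢j λ i i≢j i≢x →
                  n<1⇒n≡0 (≰⇒> λ 1≤ui → none (i , i≢j , i≢x , 1≤ui))
    }

  dominatorPair : ∀ {p q} → p ≢ q → 1 ≤ u p → 1 ≤ u q → DominatorPair j t u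
  dominatorPair {p} {q} p≢q 1≤up 1≤uq with p Fin.≟ j | q Fin.≟ j
  ... | no p≢j   | no q≢j   = dominatorPair-outer p≢q p≢j q≢j 1≤up 1≤uq
  ... | yes refl | _        = dominatorPair-centre (p≢q ∘ sym) 1≤uq 1≤up
  ... | no p≢j   | yes refl = dominatorPair-centre p≢j 1≤up 1≤uq

head-∈ : ∀ {A : Set} {xs : List A} {x ys} → xs ≡ x ∷ ys → x ∈ xs
head-∈ refl = here refl

filter-filter-¬ : ∀ {A : Set} (P Q R : A → Bool) → (∀ x → P x ∧ not (Q x) ≡ R x) → ∀ xs →
                  filter (λ x → ¬? (Q x Bool.≟ true)) (filter (λ x → P x Bool.≟ true) xs)
                  ≡ filter (λ x → R x Bool.≟ true) xs
filter-filter-¬ P Q R P∧¬Q≡R [] = refl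
filter-filter-¬ P Q R P∧¬Q≡R (x ∷ xs) rewrite sym (P∧¬Q≡R x) with P x
... | false = filter-filter-¬ P Q R P∧¬Q≡R xs
... | true with Q x
...   | true  = filter-filter-¬ P Q R P∧¬Q≡R xs
...   | false = cong (x ∷_) (filter-filter-¬ P Q R P∧¬Q≡R xs)

minL-≤ : ∀ G {y} xs → y ∈ xs → minL G xs ≤ y
minL-≤ G (x ∷ xs) y∈ = foldr-preservesᵒ (λ a b → [ m≤n⇒m⊓o≤n b , m≤n⇒o⊓m≤n a ]) x xs
  (Data.Sum.map ≥-reflexive (Any.map ≥-reflexive) (Any.toSum y∈))
  where
  ≥-reflexive : ∀ {a b} → b ≡ a → a ≤ b
  ≥-reflexive = ≤-reflexive ∘ sym

maxL-≤ : ∀ G {b} xs → All (_≤ b) xs → maxL G xs ≤ b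
maxL-≤ G xs = foldr-preservesᵇ ⊔-lub z≤n

∧-not-∨₄ : ∀ x y ac ad bc bd →
           (x ∧ y) ∧ not (ac ∨ ad ∨ bc ∨ bd) ≡ (x ∧ not (ac ∨ bc)) ∧ (y ∧ not (ad ∨ bd))
∧-not-∨₄ x y ac ad bc bd = begin
  (x ∧ y) ∧ not (ac ∨ ad ∨ bc ∨ bd)
    ≡⟨ cong ((x ∧ y) ∧_) (trans (deMorgan₂ ac _) (cong (not ac ∧_)
         (trans (deMorgan₂ ad _) (cong (not ad ∧_) (deMorgan₂ bc bd))))) ⟩
  (x ∧ y) ∧ (not ac ∧ (not ad ∧ (not bc ∧ not bd)))
    ≡⟨ solve 6 (λ x y a b c d → (x ⊕ y) ⊕ (a ⊕ (b ⊕ (c ⊕ d))) ⊜ (x ⊕ (a ⊕ c)) ⊕ (y ⊕ (b ⊕ d)))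
         refl x y (not ac) (not ad) (not bc) (not bd) ⟩
  (x ∧ (not ac ∧ not bc)) ∧ (y ∧ (not ad ∧ not bd))
    ≡⟨ cong₂ (λ p q → (x ∧ p) ∧ (y ∧ q)) (deMorgan₂ ac bc) (deMorgan₂ ad bd) ⟨
  (x ∧ not (ac ∨ bc)) ∧ (y ∧ not (ad ∨ bd))
    ∎
  where open ≡-Reasoning

∧-≡true⁻ : ∀ {x y} → x ∧ y ≡ true → x ≡ true × y ≡ true
∧-≡true⁻ {true} {true} _ = refl , refl

bit : Bool → ℕ
bit false = 0
bit true  = 1

bit-∧-≤ : ∀ x y → bit (x ∧ y) ≤ bit x
bit-∧-≤ false y     = z≤n
bit-∧-≤ true  false = z≤n
bit-∧-≤ true  true  = ≤-refl

bit-∧-not-< : ∀ {x y} → x ≡ true → y ≡ true → bit (x ∧ not y) < bit x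
bit-∧-not-< refl refl = s≤s z≤n

1≤bit⇒≡true : ∀ {x} → 1 ≤ bit x → x ≡ true
1≤bit⇒≡true {true} _ = refl

-- The game on complete multipartite graphs

module Multipartite {n : ℕ} (m : Fin n → ℕ) where

  G : Graph
  G = completeMultipartite n m

  open Graph G using (V; _≟V_; edges)

  vertices : List V
  vertices = concatMap (λ j → map (j ,_) (allFin (m j))) (allFin n)

  ∈-vertices : ∀ x → x ∈ vertices
  ∈-vertices (j , i) = ∈-concatMap⁺ (λ j → map (j ,_) (allFin (m j)))
    (Any.map (λ { refl → ∈-map⁺ (j ,_) (∈-allFin i) }) (∈-allFin j))

  IsEdge : Edge G → Set
  IsEdge (x , y) = toℕ (proj₁ x) < toℕ (proj₁ y)

  isEdge? : ∀ e → Dec (IsEdge e)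
  isEdge? (x , y) = toℕ (proj₁ x) <? toℕ (proj₁ y)

  ∈-edges⁺ : ∀ {e} → IsEdge e → e ∈ edges
  ∈-edges⁺ {x , y} = ∈-filter⁺ isEdge? (∈-concatMap⁺ (λ u → map (u ,_) vertices)
    (Any.map (λ { refl → ∈-map⁺ (x ,_) (∈-vertices y) }) (∈-vertices x)))

  ∈-edges⁻ : ∀ {e} → e ∈ edges → IsEdge e
  ∈-edges⁻ e∈ = proj₂ (∈-filter⁻ isEdge? {xs = concatMap (λ u → map (u ,_) vertices) vertices} e∈)

  bothUncovered : (V → Bool) → Edge G → Bool
  bothUncovered U (x , y) = U x ∧ U y

  residual : (V → Bool) → List (Edge G)
  residual U = filter (λ e → bothUncovered U e Bool.≟ true) edges

  residual⁺ : ∀ U {x y} → IsEdge (x , y) → U x ≡ true → U y ≡ true → (x , y) ∈ residual U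
  residual⁺ U x<y Ux Uy =
    ∈-filter⁺ (λ e → bothUncovered U e Bool.≟ true) (∈-edges⁺ x<y) (cong₂ _∧_ Ux Uy)

  residual⁻ : ∀ U {e} → e ∈ residual U → e ∈ edges × bothUncovered U e ≡ true
  residual⁻ U = ∈-filter⁻ (λ e → bothUncovered U e Bool.≟ true) {xs = edges}

  residual-all : residual (λ _ → true) ≡ edges
  residual-all = filter-all (λ e → bothUncovered (λ _ → true) e Bool.≟ true) (universal (λ _ → refl) edges)

  hits : Edge G → V → Bool
  hits (a , b) z = ⌊ a ≟V z ⌋ ∨ ⌊ b ≟V z ⌋

  cover : Edge G → (V → Bool) → V → Bool
  cover e U z = U z ∧ not (hits e z)

  remaining : Edge G → List (Edge G) → List (Edge G)
  remaining e R = filter (λ f → ¬? (meets G e f Bool.≟ true)) R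

  legalMoves : List (Edge G) → List (Edge G)
  legalMoves R = filter (λ e → any (meets G e) R Bool.≟ true) edges

  ⌊≟V⌋-refl : ∀ x → ⌊ x ≟V x ⌋ ≡ true
  ⌊≟V⌋-refl x with x ≟V x
  ... | yes _  = refl
  ... | no x≢x = contradiction refl x≢x

  hits-proj₁ : ∀ e → hits e (proj₁ e) ≡ true
  hits-proj₁ (a , b) = cong (_∨ ⌊ b ≟V a ⌋) (⌊≟V⌋-refl a)

  hits-proj₂ : ∀ e → hits e (proj₂ e) ≡ true
  hits-proj₂ (a , b) = trans (cong (⌊ a ≟V b ⌋ ∨_) (⌊≟V⌋-refl b)) (∨-zeroʳ _)

  meets-refl : ∀ e → meets G e e ≡ true
  meets-refl (a , b) = cong (_∨ (⌊ a ≟V b ⌋ ∨ ⌊ b ≟V a ⌋ ∨ ⌊ b ≟V b ⌋)) (⌊≟V⌋-refl a)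

  ∈-legalMoves : ∀ R {e} → e ∈ R → e ∈ edges → e ∈ legalMoves R
  ∈-legalMoves R {e} e∈R e∈edges = ∈-filter⁺ (λ e → any (meets G e) R Bool.≟ true) e∈edges
    (Equivalence.to T-≡ (any⁺ (meets G e) (Any.map (λ { refl → Equivalence.from T-≡ (meets-refl e) }) e∈R)))

  residual-cover : ∀ e U → remaining e (residual U) ≡ residual (cover e U)
  residual-cover (a , b) U =
    filter-filter-¬ (bothUncovered U) (meets G (a , b)) (bothUncovered (cover (a , b) U))
      (λ (c , d) → ∧-not-∨₄ (U c) (U d) ⌊ a ≟V c ⌋ ⌊ a ≟V d ⌋ ⌊ b ≟V c ⌋ ⌊ b ≟V d ⌋) edges

  remaining-residual : ∀ U {R} e → residual U ≡ R → remaining e R ≡ residual (cover e U)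
  remaining-residual U e refl = residual-cover e U

  uncoveredIn : (V → Bool) → Fin n → ℕ
  uncoveredIn U j = ∑ λ i → bit (U (j , i))

  uncoveredIn-all : ∀ j → uncoveredIn (λ _ → true) j ≡ m j
  uncoveredIn-all j = trans (∑-const (m j) 1) (*-identityʳ (m j))

  uncoveredIn-cover : ∀ e U → uncoveredIn (cover e U) ≤̇ uncoveredIn U
  uncoveredIn-cover e U j = ∑-mono-≤ λ i → bit-∧-≤ (U (j , i)) _

  uncoveredIn-cover-< : ∀ e U {z} → U z ≡ true → hits e z ≡ true →
                        uncoveredIn (cover e U) (proj₁ z) < uncoveredIn U (proj₁ z)
  uncoveredIn-cover-< e U {j , i} Uz hz = ∑-mono-< i (λ i → bit-∧-≤ (U (j , i)) _) (bit-∧-not-< Uz hz)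

  uncovered⇒1≤uncoveredIn : ∀ U {j i} → U (j , i) ≡ true → 1 ≤ uncoveredIn U j
  uncovered⇒1≤uncoveredIn U {j} {i} Uz =
    ≤-trans (≤-reflexive (cong bit (sym Uz))) (term≤∑ (λ i → bit (U (j , i))) i)

  1≤uncoveredIn⇒uncovered : ∀ U {j} → 1 ≤ uncoveredIn U j → ∃ λ i → U (j , i) ≡ true
  1≤uncoveredIn⇒uncovered U {j} 1≤ with ∑-pos⇒∃-pos (λ i → bit (U (j , i))) 1≤
  ... | i , 1≤bit = i , 1≤bit⇒≡true 1≤bit

  residual⇒twoParts : ∀ U {e} → e ∈ residual U →
                      ∃₂ λ p q → p ≢ q × 1 ≤ uncoveredIn U p × 1 ≤ uncoveredIn U q
  residual⇒twoParts U {(j , i) , (j′ , i′)} e∈ with residual⁻ U e∈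
  ... | e∈edges , both with ∧-≡true⁻ both
  ...   | Ux , Uy = j , j′ , (λ j≡j′ → <-irrefl (cong toℕ j≡j′) (∈-edges⁻ e∈edges)) ,
                    uncovered⇒1≤uncoveredIn U Ux , uncovered⇒1≤uncoveredIn U Uy

  CoveringMove : (V → Bool) → Fin n → Fin n → Set
  CoveringMove U p q = ∃ λ e → e ∈ residual U ×
    uncoveredIn (cover e U) p < uncoveredIn U p × uncoveredIn (cover e U) q < uncoveredIn U q

  coveringMove-edge : ∀ U {x y} → IsEdge (x , y) → U x ≡ true → U y ≡ true →
                      CoveringMove U (proj₁ x) (proj₁ y)
  coveringMove-edge U {x} {y} x<y Ux Uy = (x , y) , residual⁺ U x<y Ux Uy ,
    uncoveredIn-cover-< (x , y) U Ux (hits-proj₁ (x , y)) ,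
    uncoveredIn-cover-< (x , y) U Uy (hits-proj₂ (x , y))

  coveringMove : ∀ U {p q} → p ≢ q → 1 ≤ uncoveredIn U p → 1 ≤ uncoveredIn U q → CoveringMove U p q
  coveringMove U {p} {q} p≢q 1≤p 1≤q
    with 1≤uncoveredIn⇒uncovered U 1≤p | 1≤uncoveredIn⇒uncovered U 1≤q | <-cmp (toℕ p) (toℕ q)
  ... | _ , Ux | _ , Uy | tri< p<q _ _ = coveringMove-edge U p<q Ux Uy
  ... | _      | _      | tri≈ _ p≡q _ = contradiction (Fin.toℕ-injective p≡q) p≢q
  ... | _ , Ux | _ , Uy | tri> _ _ q<p with coveringMove-edge U q<p Uy Ux
  ...   | e , e∈ , q-dec , p-dec = e , e∈ , p-dec , q-dec

  module _ (j : Fin n) where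

    residual⇒1≤t : ∀ U {t r} → Balanced j t (uncoveredIn U) → r ∈ residual U → 1 ≤ t
    residual⇒1≤t U bal r∈ with residual⇒twoParts U r∈
    ... | _ , _ , p≢q , 1≤p , 1≤q = Balanced⇒1≤t bal p≢q 1≤p 1≤q

    dominatorMove : ∀ U {t r} → Balanced j t (uncoveredIn U) → r ∈ residual U →
                    ∃ λ e → e ∈ residual U × Balanced j (pred t) (uncoveredIn (cover e U))
    dominatorMove U bal r∈ with residual⇒twoParts U r∈
    ... | _ , _ , p≢q , 1≤p , 1≤q with dominatorPair bal p≢q 1≤p 1≤q
    ... | record { p≢q = p′≢q′ ; 1≤u[p] = 1≤p′ ; 1≤u[q] = 1≤q′ ; reduces = reduces }
      with coveringMove U p′≢q′ 1≤p′ 1≤q′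
    ... | e , e∈ , p′-dec , q′-dec = e , e∈ , reduces _ (uncoveredIn-cover e U) p′-dec q′-dec

    dominator-bound : ∀ fuel U {t} → Balanced j t (uncoveredIn U) →
                      game G fuel true (residual U) ≤ 2 * t ∸ 1
    staller-bound   : ∀ fuel U {t} → Balanced j t (uncoveredIn U) →
                      game G fuel false (residual U) ≤ 2 * t

    dominator-bound zero U bal = z≤n
    dominator-bound (suc fuel) U {t} bal with residual U in eq
    ... | []     = z≤n
    ... | r ∷ rs = move (dominatorMove U bal (head-∈ eq))
      where
      value : Edge G → ℕ
      value e = game G fuel false (remaining e (r ∷ rs))
      move : (∃ λ e → e ∈ residual U × Balanced j (pred t) (uncoveredIn (cover e U))) →
             suc (minL G (map value (legalMoves (r ∷ rs)))) ≤ 2 * t ∸ 1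
      move (e , e∈ , bal′) = begin
        suc (minL G (map value (legalMoves (r ∷ rs))))  ≤⟨ s≤s (minL-≤ G _ (∈-map⁺ value e∈legal)) ⟩
        suc (value e)                                   ≡⟨ cong (suc ∘ game G fuel false) (remaining-residual U e eq) ⟩
        suc (game G fuel false (residual (cover e U)))  ≤⟨ s≤s (staller-bound fuel (cover e U) bal′) ⟩
        suc (2 * pred t)                                ≡⟨ suc[2*pred]≡2*∸1 (residual⇒1≤t U bal e∈) ⟩
        2 * t ∸ 1                                       ∎
        where
        open ≤-Reasoning
        e∈legal : e ∈ legalMoves (r ∷ rs)
        e∈legal = ∈-legalMoves (r ∷ rs) (subst (e ∈_) eq e∈) (proj₁ (residual⁻ U e∈))

    staller-bound zero U bal = z≤n
    staller-bound (suc fuel) U {t} bal with residual U in eq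
    ... | []     = z≤n
    ... | r ∷ rs = begin
      suc (maxL G (map value legal))  ≤⟨ s≤s (maxL-≤ G _ (map⁺ (universal value≤ legal))) ⟩
      suc (2 * t ∸ 1)                 ≡⟨ suc[2*∸1]≡2* (residual⇒1≤t U bal (head-∈ eq)) ⟩
      2 * t                           ∎
      where
      open ≤-Reasoning
      value : Edge G → ℕ
      value e = game G fuel true (remaining e (r ∷ rs))
      legal : List (Edge G)
      legal = legalMoves (r ∷ rs)
      value≤ : ∀ e → value e ≤ 2 * t ∸ 1
      value≤ e = subst (_≤ 2 * t ∸ 1) (cong (game G fuel true) (sym (remaining-residual U e eq)))
        (dominator-bound fuel (cover e U) (Balanced-antitone (uncoveredIn-cover e U) bal))

inject₁≤inject₁[fromℕ] : ∀ {k} (i : Fin (suc k)) → inject₁ i Data.Fin.≤ inject₁ (fromℕ k)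
inject₁≤inject₁[fromℕ] {k} i =
  subst₂ _≤_ (sym (Fin.toℕ-inject₁ i)) (sym (Fin.toℕ-inject₁ (fromℕ k))) (Fin.≤fromℕ i)

Balanced-sorted : ∀ {k} (m : Fin (2 + k) → ℕ) → (∀ i j → i Data.Fin.≤ j → m i ≤ m j) →
                  Balanced (fromℕ (suc k))
                    (⌈ sum (map (λ j → m (inject₁ j)) (allFin (1 + k))) /2⌉ ⊔ m (inject₁ (fromℕ k))) m
Balanced-sorted {k} m mono = Balanced-last m ∑init≤ init≤
  where
  s : ℕ
  s = sum (map (λ j → m (inject₁ j)) (allFin (1 + k)))
  ∑init≤ : ∑ (init m) ≤ 2 * (⌈ s /2⌉ ⊔ m (inject₁ (fromℕ k)))
  ∑init≤ = begin
    ∑ (init m)                             ≡⟨ sum-map-allFin (init m) ⟨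
    s                                      ≤⟨ n≤2*⌈n/2⌉ s ⟩
    2 * ⌈ s /2⌉                            ≤⟨ *-monoʳ-≤ 2 (m≤m⊔n ⌈ s /2⌉ (m (inject₁ (fromℕ k)))) ⟩
    2 * (⌈ s /2⌉ ⊔ m (inject₁ (fromℕ k)))  ∎
    where open ≤-Reasoning
  init≤ : ∀ i → m (inject₁ i) ≤ ⌈ s /2⌉ ⊔ m (inject₁ (fromℕ k))
  init≤ i = ≤-trans (mono _ _ (inject₁≤inject₁[fromℕ] i)) (m≤n⊔m ⌈ s /2⌉ _)

-- Opened only here: Data.Fin's _≤_ would clash with ℕ's in the development above.
open import Data.Fin using (Fin; fromℕ; inject₁; _≤_)

proposition11 : (k : ℕ) → (m : Fin (2 + k) → ℕ)
    → (∀ i → 1 Data.Nat.≤ m i)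
    → (∀ i j → i Data.Fin.≤ j → m i Data.Nat.≤ m j)
    → γeg (completeMultipartite (2 + k) m)
    Data.Nat.≤ 2 * (⌈ sum (map (λ j → m (inject₁ j)) (allFin (1 + k))) /2⌉
    ⊔ m (inject₁ (fromℕ k))) ∸ 1
proposition11 k m _ mono = begin
  γeg G                                             ≡⟨ cong (game G (length edges) true) residual-all ⟨
  game G (length edges) true (residual λ _ → true)  ≤⟨ dominator-bound (fromℕ (suc k)) (length edges) _ balanced ⟩
  2 * t ∸ 1                                         ∎
  where
  open ≤-Reasoning
  open Multipartite m
  open Graph G using (edges)
  t : ℕ
  t = ⌈ sum (map (λ j → m (inject₁ j)) (allFin (1 + k))) /2⌉ ⊔ m (inject₁ (fromℕ k))
  balanced : Balanced (fromℕ (suc k)) t (uncoveredIn λ _ → true)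
  balanced = Balanced-antitone (≤-reflexive ∘ uncoveredIn-all) (Balanced-sorted m mono)
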